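{- Let $\mathcal{F}$ be a CNF formula, let $c_i, c_j \in \mathcal{F}$ with $L(c_i,c_j) = \{l\}$ for a literal $l$ (so $(c_i,c_j) \in P_{\mathcal{F}}$). If there is a literal $l' \neq l$ such that $\mathcal{F} \setminus \{c_i,c_j\} \models l \leftrightarrow l'$, then the edge $(c_i,c_j)$ is blocked.
   Context: A literal is a Boolean variable $x$ or its negation $\lnot x$, with $\lnot\lnot l = l$. A clause is a non-empty set of literals (a disjunction); a CNF formula $\mathcal{F}$ is a set of clauses (a conjunction). An assignment is a set of literals $a$ such that $l \in a$ implies $\lnot l \notin a$. The assignment $a$ satisfies a clause $c$ if $a \cap c \neq \emptyset$, and satisfies a formula if it satisfies all of its clauses. An assignment $a$ is complete for $\mathcal{F}$ if for every $c \in \mathcal{F}$ and every $l \in c$, either $l \in a$ or $\lnot l \in a$. The notation $\mathcal{G} \models l \leftrightarrow l'$ means that every truth assignment satisfying all clauses of $\mathcal{G}$ gives $l$ and $l'$ the same truth value. An associated assignment (assoc) for a clause $c \in \mathcal{F}$ is a complete assignment for $\mathcal{F}$ that satisfies $\mathcal{F} \setminus \{c\}$ and does not satisfy $c$. The set of all assocs for $c$ is denoted $A(c,\mathcal{F})$. For an assignment $a$ and a literal $l$, define $\mathrm{flip}(a,l) = (a \setminus \{l\}) \cup \{\lnot l\}$. For clauses $c_i, c_j$, let $L(c_i,c_j) = \{ l \mid l \in c_i \text{ and } \lnot l \in c_j\}$. Define $P_{\mathcal{F}} = \{(c_i,c_j) \mid c_i, c_j \in \mathcal{F},\ |L(c_i,c_j)|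 = 1\}$. An edge $(c_i,c_j) \in P_{\mathcal{F}}$ is blocked if, where $l$ is the unique literal with $L(c_i,c_j) = \{l\}$, for every $a_i \in A(c_i,\mathcal{F})$ we have $\mathrm{flip}(a_i,\lnot l) \notin A(c_j,\mathcal{F})$. -}

module Defs where

open import Data.Nat using (ℕ)
open import Data.Bool using (Bool; true; false; not)
open import Data.List using (List; [])
open import Data.List.Membership.Propositional using (_∈_)
open import Data.Product using (Σ; ∃; _×_; _,_)
open import Data.Sum using (_⊎_)
open import Relation.Nullary using (¬_)
open import Relation.Binary.PropositionalEquality using (_≡_; _≢_)
open import Function.Bundles using (_⇔_)

data Literal : Set where
  pos : ℕ → Literal
  neg : ℕ → Literal

¬ₗ : Literal → Literal
¬ₗ (pos x) = neg x
¬ₗ (neg x) = pos x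

-- A clause is a finite set of literals, represented by a list (read as the set of its elements)
Clause : Set
Clause = List Literal

Formula : Set
Formula = List Clause

_≐_ : Clause → Clause → Set
c ≐ d = ∀ l → (l ∈ c) ⇔ (l ∈ d)

IsCNF : Formula → Set
IsCNF F = ∀ c → c ∈ F → c ≢ []

_∈_∖_ : Clause → Formula → Clause → Set
d ∈ F ∖ c = d ∈ F × ¬ (d ≐ c)

_∈_∖₂_,_ : Clause → Formula → Clause → Clause → Set
d ∈ F ∖₂ c₁ , c₂ = d ∈ F × ¬ (d ≐ c₁) × ¬ (d ≐ c₂)

-- An assignment: a set of literals (as a predicate), consistency required separately
Assignment : Set₁
Assignment = Literal → Set

IsAssignment : Assignment → Set
IsAssignment a = ∀ l → a l → ¬ a (¬ₗ l)

SatClause : Assignment → Clause → Set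
SatClause a c = ∃ λ l → l ∈ c × a l

Complete : Assignment → Formula → Set
Complete a F = ∀ c → c ∈ F → ∀ l → l ∈ c → a l ⊎ a (¬ₗ l)

Assoc : Clause → Formula → Assignment → Set
Assoc c F a =
  IsAssignment a × Complete a F
  × (∀ d → d ∈ F ∖ c → SatClause a d)
  × ¬ SatClause a c

flip : Assignment → Literal → Assignment
flip a l x = (a x × x ≢ l) ⊎ x ≡ ¬ₗ l

LSingleton : Clause → Clause → Literal → Set
LSingleton ci cj l = ∀ x → (x ∈ ci × ¬ₗ x ∈ cj) ⇔ (x ≡ l)

Valuation : Set
Valuation = ℕ → Bool

val : Valuation → Literal → Bool
val τ (pos x) = τ x
val τ (neg x) = not (τ x)

SatClauseV : Valuation → Clause → Set
SatClauseV τ c = ∃ λ l → l ∈ c × val τ l ≡ true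

EntailsEquiv₂ : Formula → Clause → Clause → Literal → Literal → Set
EntailsEquiv₂ F c₁ c₂ l l' =
  ∀ (τ : Valuation) → (∀ d → d ∈ F ∖₂ c₁ , c₂ → SatClauseV τ d) → val τ l ≡ val τ l'

Blocked : Formula → Clause → Clause → Literal → Set₁
Blocked F ci cj l = ∀ (a : Assignment) → Assoc ci F a → ¬ Assoc cj F (flip a (¬ₗ l))

-- Take an assoc a for cᵢ and suppose flip(a, ¬l) were an assoc for cⱼ. Since l ∈ cᵢ is
-- unsatisfied, a makes l false; realise a as a truth assignment τ on the variables of F,
-- and let τ' be τ with l made true. Then τ' realises flip(a, ¬l), so both τ and τ' satisfy
-- F ∖ {cᵢ, cⱼ}. As l' ≠ l and l' ↔ l is entailed, l' cannot be ¬l, so l' lives on another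
-- variable and takes the same value under τ and τ'; yet it must follow l, which changes value.
module Submission where

open import Defs
open import Data.List.Membership.Propositional using (_∈_)
open import Relation.Binary.PropositionalEquality using (_≢_)

open import Data.Nat using (ℕ; _≟_)
open import Data.Bool using (Bool; true; false; not)
open import Data.Bool.Properties using (not-involutive; not-¬)
open import Data.List using (List; []; _∷_; concat)
open import Data.List.Relation.Unary.Any using (here; there)
open import Data.List.Membership.Propositional.Properties using (∈-concat⁺′; ∈-concat⁻′)
open import Data.Product using (Σ; _,_; proj₁; proj₂)
open import Data.Sum using (_⊎_; inj₁; inj₂)
open import Data.Empty using (⊥-elim)
open import Relation.Nullary using (yes; no)
open import Relation.Binary.PropositionalEquality using (_≡_; refl; sym; trans; subst; module ≡-Reasoning)
open import Function.Bundles using (Equivalence)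

var : Literal → ℕ
var (pos x) = x
var (neg x) = x

sign : Literal → Bool
sign (pos _) = true
sign (neg _) = false

¬ₗ-involutive : ∀ m → ¬ₗ (¬ₗ m) ≡ m
¬ₗ-involutive (pos x) = refl
¬ₗ-involutive (neg x) = refl

same-var⇒≡⊎≡¬ₗ : ∀ y m → var y ≡ var m → y ≡ m ⊎ y ≡ ¬ₗ m
same-var⇒≡⊎≡¬ₗ (pos x) (pos .x) refl = inj₁ refl
same-var⇒≡⊎≡¬ₗ (pos x) (neg .x) refl = inj₂ refl
same-var⇒≡⊎≡¬ₗ (neg x) (pos .x) refl = inj₂ refl
same-var⇒≡⊎≡¬ₗ (neg x) (neg .x) refl = inj₁ refl

val-¬ₗ : ∀ τ m → val τ (¬ₗ m) ≡ not (val τ m)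
val-¬ₗ τ (pos x) = refl
val-¬ₗ τ (neg x) = sym (not-involutive (τ x))

satisfy : Valuation → Literal → Valuation
satisfy τ m y with y ≟ var m
... | yes _ = sign m
... | no _  = τ y

satisfy-self : ∀ τ m → val (satisfy τ m) m ≡ true
satisfy-self τ (pos x) with x ≟ x
... | yes _ = refl
... | no x≢x = ⊥-elim (x≢x refl)
satisfy-self τ (neg x) with x ≟ x
... | yes _ = refl
... | no x≢x = ⊥-elim (x≢x refl)

satisfy-other : ∀ τ m y → var y ≢ var m → val (satisfy τ m) y ≡ val τ y
satisfy-other τ m (pos y) y≢m with y ≟ var m
... | yes y≡m = ⊥-elim (y≢m y≡m)
... | no _ = refl
satisfy-other τ m (neg y) y≢m with y ≟ var m
... | yes y≡m = ⊥-elim (y≢m y≡m)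
... | no _ = refl

satisfy-preserves : ∀ τ m y → val τ y ≡ true → y ≢ ¬ₗ m → val (satisfy τ m) y ≡ true
satisfy-preserves τ m y τy y≢¬m with var y ≟ var m
... | no y≉m = trans (satisfy-other τ m y y≉m) τy
... | yes y≈m with same-var⇒≡⊎≡¬ₗ y m y≈m
...   | inj₁ refl = satisfy-self τ m
...   | inj₂ y≡¬m = ⊥-elim (y≢¬m y≡¬m)

Realises : Assignment → Valuation → List Literal → Set
Realises a τ Ls = ∀ y → y ∈ Ls → a y → val τ y ≡ true

realises-satisfy : ∀ {a τ Ls k} → IsAssignment a → a k → Realises a τ Ls → Realises a (satisfy τ k) Ls
realises-satisfy {τ = τ} {k = k} consistent ak ρ y y∈ ay =
  satisfy-preserves τ k y (ρ y y∈ ay) λ { refl → consistent k ak ay }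

realise : ∀ {a} → IsAssignment a → (Ls : List Literal) → (∀ m → m ∈ Ls → a m ⊎ a (¬ₗ m))
  → Σ Valuation λ τ → Realises a τ Ls
realise consistent [] decided = (λ _ → false) , λ _ ()
realise {a} consistent (m ∷ Ls) decided
  with realise consistent Ls (λ y y∈ → decided y (there y∈)) | decided m (here refl)
... | τ , ρ | inj₁ am = satisfy τ m , ρ′
  where
  ρ′ : Realises a (satisfy τ m) (m ∷ Ls)
  ρ′ y (here refl) _ = satisfy-self τ m
  ρ′ y (there y∈) ay = realises-satisfy consistent am ρ y y∈ ay
... | τ , ρ | inj₂ a¬m = satisfy τ (¬ₗ m) , ρ′
  where
  ρ′ : Realises a (satisfy τ (¬ₗ m)) (m ∷ Ls)
  ρ′ y (here refl) ay = ⊥-elim (consistent y ay a¬m)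
  ρ′ y (there y∈) ay = realises-satisfy consistent a¬m ρ y y∈ ay

realise-complete : ∀ {a} F → IsAssignment a → Complete a F → Σ Valuation λ τ → Realises a τ (concat F)
realise-complete {a} F consistent complete = realise consistent (concat F) decided
  where
  decided : ∀ m → m ∈ concat F → a m ⊎ a (¬ₗ m)
  decided m m∈ with ∈-concat⁻′ F m∈
  ... | d , m∈d , d∈F = complete d d∈F m m∈d

realises-flip : ∀ {a τ} Ls k → Realises a τ Ls → Realises (flip a (¬ₗ k)) (satisfy τ k) Ls
realises-flip {τ = τ} Ls k ρ y y∈ (inj₁ (ay , y≢¬k)) = satisfy-preserves τ k y (ρ y y∈ ay) y≢¬k
realises-flip {τ = τ} Ls k ρ y y∈ (inj₂ y≡¬¬k) =
  subst (λ z → val (satisfy τ k) z ≡ true) (sym (trans y≡¬¬k (¬ₗ-involutive k))) (satisfy-self τ k)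

realises-sat : ∀ {a τ F d} → Realises a τ (concat F) → d ∈ F → SatClause a d → SatClauseV τ d
realises-sat ρ d∈F (m , m∈d , am) = m , m∈d , ρ m (∈-concat⁺′ m∈d d∈F) am

equal-value⇒distinct-var : ∀ τ l l' → l' ≢ l → val τ l ≡ val τ l' → var l' ≢ var l
equal-value⇒distinct-var τ l l' l'≢l l≡l' l'≈l with same-var⇒≡⊎≡¬ₗ l' l l'≈l
... | inj₁ l'≡l = l'≢l l'≡l
... | inj₂ refl = not-¬ refl (trans l≡l' (val-¬ₗ τ l))

assoc-falsifies : ∀ {c F a l} → Assoc c F a → c ∈ F → l ∈ c → a (¬ₗ l)
assoc-falsifies {l = l} (_ , complete , _ , unsat) c∈F l∈c with complete _ c∈F l l∈c
... | inj₁ al = ⊥-elim (unsat (l , l∈c , al))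
... | inj₂ a¬l = a¬l

lemma1 : (F : Formula) → IsCNF F → (ci cj : Clause) → ci ∈ F → cj ∈ F
    → (l : Literal) → LSingleton ci cj l
    → (l' : Literal) → l' ≢ l → EntailsEquiv₂ F ci cj l l'
    → Blocked F ci cj l
lemma1 F _ ci cj ci∈F cj∈F l L≡l l' l'≢l entails a assocA@(consistent , complete , satA , _)
       (_ , _ , satB , _) = not-¬ τ-l-true (trans (sym τ-¬l) (val-¬ₗ τ l))
  where
  l∈ci : l ∈ ci
  l∈ci = proj₁ (Equivalence.from (L≡l l) refl)
  ¬l∈cj : ¬ₗ l ∈ cj
  ¬l∈cj = proj₂ (Equivalence.from (L≡l l) refl)

  τ : Valuation
  τ = proj₁ (realise-complete F consistent complete)
  ρ : Realises a τ (concat F)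
  ρ = proj₂ (realise-complete F consistent complete)
  τ′ : Valuation
  τ′ = satisfy τ l

  τ-models : ∀ d → d ∈ F ∖₂ ci , cj → SatClauseV τ d
  τ-models d (d∈F , d≉ci , _) = realises-sat ρ d∈F (satA d (d∈F , d≉ci))
  τ′-models : ∀ d → d ∈ F ∖₂ ci , cj → SatClauseV τ′ d
  τ′-models d (d∈F , _ , d≉cj) = realises-sat (realises-flip (concat F) l ρ) d∈F (satB d (d∈F , d≉cj))

  τ-¬l : val τ (¬ₗ l) ≡ true
  τ-¬l = ρ (¬ₗ l) (∈-concat⁺′ ¬l∈cj cj∈F) (assoc-falsifies assocA ci∈F l∈ci)
  τ-l≡l' : val τ l ≡ val τ l'
  τ-l≡l' = entails τ τ-models
  l'≉l : var l' ≢ var l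
  l'≉l = equal-value⇒distinct-var τ l l' l'≢l τ-l≡l'

  open ≡-Reasoning
  τ-l-true : true ≡ val τ l
  τ-l-true = begin
    true       ≡⟨ sym (satisfy-self τ l) ⟩
    val τ′ l   ≡⟨ entails τ′ τ′-models ⟩
    val τ′ l'  ≡⟨ satisfy-other τ l l' l'≉l ⟩
    val τ l'   ≡⟨ sym τ-l≡l' ⟩
    val τ l    ∎
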